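{- Let $f:L\to M$ be a function between o-algebras. If $f$ is symmetrizable, then $f$ preserves all joins; and the converse holds classically (i.e. assuming the law of excluded middle).
   Context: Work in intuitionistic logic without choice. A positivity predicate on a complete lattice $L$ is a unary predicate $\mathrm{Pos}$ such that: (i) $\mathrm{Pos}(x)$ and $x\le y$ imply $\mathrm{Pos}(y)$; (ii) $\mathrm{Pos}(\bigvee X)$ implies $\mathrm{Pos}(x)$ for some $x\in X$; (iii) if $\mathrm{Pos}(x)\Rightarrow x\le y$, then $x\le y$. An o-algebra is a frame $L$ with a positivity predicate such that for all $x,y$: if $\mathrm{Pos}(z\wedge x)\Rightarrow\mathrm{Pos}(z\wedge y)$ for every $z\in L$, then $x\le y$. Write $x\bowtie y$ (overlap) for $\mathrm{Pos}(x\wedge y)$. Functions $f:L\to M$ and $g:M\to L$ between o-algebras are symmetric if $f(x)\bowtie y \iff x\bowtie g(y)$ for all $x\in L$, $y\in M$. A function has at most one symmetric; $f$ is symmetrizable if it has one, denoted $f^\dagger$. -}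

module Defs where

open import Level using (Level; suc)
open import Data.Product using (Σ; ∃; _×_; _,_)
open import Relation.Binary.PropositionalEquality using (_≡_)
open import Relation.Unary using (Pred; _∈_)

record OAlgebra (c : Level) : Set (suc c) where
  infix  4 _≤_
  infixr 7 _∧_
  field
    Carrier : Set c
    _≤_     : Carrier → Carrier → Set c
    ≤-refl    : ∀ {x} → x ≤ x
    ≤-trans   : ∀ {x y z} → x ≤ y → y ≤ z → x ≤ z
    ≤-antisym : ∀ {x y} → x ≤ y → y ≤ x → x ≡ y
    ⋁       : Pred Carrier c → Carrier
    ⋁-upper : ∀ (X : Pred Carrier c) {x} → x ∈ X → x ≤ ⋁ X
    ⋁-least : ∀ (X : Pred Carrier c) {y} → (∀ {x} → x ∈ X → x ≤ y) → ⋁ X ≤ y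
    _∧_     : Carrier → Carrier → Carrier
    ∧-lowerˡ : ∀ {x y} → x ∧ y ≤ x
    ∧-lowerʳ : ∀ {x y} → x ∧ y ≤ y
    ∧-greatest : ∀ {x y z} → z ≤ x → z ≤ y → z ≤ x ∧ y
    distrib : ∀ x (X : Pred Carrier c) →
              x ∧ ⋁ X ≤ ⋁ (λ z → Σ Carrier λ y → y ∈ X × z ≡ x ∧ y)
    Pos       : Carrier → Set c
    Pos-mono  : ∀ {x y} → Pos x → x ≤ y → Pos y
    Pos-⋁     : ∀ (X : Pred Carrier c) → Pos (⋁ X) → Σ Carrier λ x → x ∈ X × Pos x
    Pos-split : ∀ {x y} → (Pos x → x ≤ y) → x ≤ y
    o-axiom : ∀ {x y} → (∀ z → Pos (z ∧ x) → Pos (z ∧ y)) → x ≤ y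

  _⋈_ : Carrier → Carrier → Set c
  x ⋈ y = Pos (x ∧ y)

open OAlgebra

module _ {c : Level} (L M : OAlgebra c) where

  Symmetric : (Carrier L → Carrier M) → (Carrier M → Carrier L) → Set c
  Symmetric f g = ∀ (x : Carrier L) (y : Carrier M) →
    (_⋈_ M (f x) y → _⋈_ L x (g y)) × (_⋈_ L x (g y) → _⋈_ M (f x) y)

  Symmetrizable : (Carrier L → Carrier M) → Set c
  Symmetrizable f = Σ (Carrier M → Carrier L) λ g → Symmetric f g

  image : (Carrier L → Carrier M) → Pred (Carrier L) c → Pred (Carrier M) c
  image f X y = Σ (Carrier L) λ x → x ∈ X × f x ≡ y

  PreservesJoins : (Carrier L → Carrier M) → Set (suc c)
  PreservesJoins f = ∀ (X : Pred (Carrier L) c) → f (⋁ L X) ≡ ⋁ M (image f X)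

-- A symmetric pair is monotone, since
-- x ≤ x' turns z ⋈ f x  ⇒  g z ⋈ x  ⇒  g z ⋈ x'  ⇒  z ⋈ f x'  into f x ≤ f x'
-- by the o-algebra axiom.  The same recipe gives f (⋁X) ≤ ⋁ f[X]: an overlap
-- with f (⋁X) is transported to ⋁X, splits to some x ∈ X by the positivity
-- axiom, and comes back to f x ≤ ⋁ f[X].  Monotonicity gives the other bound.
--
-- Every o-algebra has a pseudo-complement
-- a* = ⋁{x | ¬ x ⋈ a}, and classically x ⋈ a* ⟺ ¬ x ≤ a.  If f preserves
-- joins, h y = ⋁{t | ¬ f t ⋈ y} is the largest t with ¬ f t ⋈ y, so
-- t ≤ h y ⟺ ¬ f t ⋈ y.  Hence g y = (h y)* satisfies
-- x ⋈ g y ⟺ ¬ x ≤ h y ⟺ ¬¬ f x ⋈ y ⟺ f x ⋈ y, i.e. g is the symmetric of f.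
module Submission where

open import Defs
open import Level using (Level)
open import Data.Product using (Σ; _×_; _,_; proj₁; proj₂)
open import Data.Sum using (_⊎_; inj₁; inj₂)
open import Function using (_∘_)
open import Relation.Nullary using (¬_)
open import Relation.Unary using (Pred; _∈_)
open import Relation.Binary.PropositionalEquality using (_≡_; refl; sym; subst)
open import Axiom.ExcludedMiddle using (ExcludedMiddle)
open import Axiom.DoubleNegationElimination using (DoubleNegationElimination; em⇒dne)

module OverlapFacts {c : Level} (A : OAlgebra c) where
  open OAlgebra A

  ∧-mono : ∀ {a a' b b'} → a ≤ a' → b ≤ b' → a ∧ b ≤ a' ∧ b'
  ∧-mono a≤a' b≤b' = ∧-greatest (≤-trans ∧-lowerˡ a≤a') (≤-trans ∧-lowerʳ b≤b')

  ⋈-sym : ∀ {a b} → a ⋈ b → b ⋈ a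
  ⋈-sym a⋈b = Pos-mono a⋈b (∧-greatest ∧-lowerʳ ∧-lowerˡ)

  ⋈-monoˡ : ∀ {a a' b} → a ≤ a' → a ⋈ b → a' ⋈ b
  ⋈-monoˡ a≤a' a⋈b = Pos-mono a⋈b (∧-mono a≤a' ≤-refl)

  ⋈-monoʳ : ∀ {a b b'} → b ≤ b' → a ⋈ b → a ⋈ b'
  ⋈-monoʳ b≤b' a⋈b = Pos-mono a⋈b (∧-mono ≤-refl b≤b')

  -- An overlap with a join is witnessed by a member of the join
  -- (frame distributivity followed by the positivity axiom (ii)).
  ⋈-⋁ : ∀ (X : Pred Carrier c) {w} → ⋁ X ⋈ w → Σ Carrier λ x → x ∈ X × x ⋈ w
  ⋈-⋁ X {w} ⋁X⋈w with Pos-⋁ _ (Pos-mono (⋈-sym ⋁X⋈w) (distrib w X))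
  ... | _ , (x , x∈X , refl) , w⋈x = x , x∈X , ⋈-sym w⋈x

  ≡⇒≤ : ∀ {a b} → a ≡ b → a ≤ b
  ≡⇒≤ refl = ≤-refl

  ⋁-pair : ∀ {a b} → a ≤ b → ⋁ (λ w → w ≡ a ⊎ w ≡ b) ≡ b
  ⋁-pair a≤b = ≤-antisym
    (⋁-least _ λ { (inj₁ refl) → a≤b ; (inj₂ refl) → ≤-refl })
    (⋁-upper _ (inj₂ refl))

  _* : Carrier → Carrier
  a * = ⋁ (λ x → ¬ (x ⋈ a))

  -- Overlapping a* means not lying below a (constructively) ...
  ⋈*⇒≰ : ∀ {x a} → x ⋈ (a *) → ¬ (x ≤ a)
  ⋈*⇒≰ {x} {a} x⋈a* x≤a with ⋈-⋁ _ (⋈-sym x⋈a*)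
  ... | s , ¬s⋈a , s⋈x = ¬s⋈a (⋈-monoʳ x≤a s⋈x)

  -- ... and classically the converse holds as well: if ¬ x ⋈ a* then any
  -- z ⋈ x must overlap a, for otherwise z ≤ a* and x ⋈ a*; so x ≤ a.
  ≰⇒⋈* : DoubleNegationElimination c → ∀ {x a} → ¬ (x ≤ a) → x ⋈ (a *)
  ≰⇒⋈* dne {x} {a} x≰a = dne λ ¬x⋈a* → x≰a (o-axiom λ z z⋈x →
    dne λ ¬z⋈a → ¬x⋈a* (⋈-monoʳ (⋁-upper _ ¬z⋈a) (⋈-sym z⋈x)))

module MapFacts {c : Level} (L M : OAlgebra c) (f : OAlgebra.Carrier L → OAlgebra.Carrier M) where
  module L = OAlgebra L
  module M = OAlgebra M
  open OverlapFacts L using (⋁-pair; _*; ⋈*⇒≰; ≰⇒⋈*)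
    renaming (⋈-monoˡ to ⋈-monoˡᴸ; ⋈-⋁ to ⋈-⋁ᴸ)
  open OverlapFacts M using (⋈-sym; ≡⇒≤)
    renaming (⋈-monoˡ to ⋈-monoˡᴹ; ⋈-monoʳ to ⋈-monoʳᴹ; ⋈-⋁ to ⋈-⋁ᴹ)

  Monotone : Set c
  Monotone = ∀ {x x'} → x L.≤ x' → f x M.≤ f x'

  -- Overlap transported across a symmetric pair, in the orientation used
  -- by the o-algebra axiom of M (z ⋈ f x rather than f x ⋈ z).
  module _ {g : M.Carrier → L.Carrier} (sym-fg : Symmetric L M f g) where

    ⋈f⇒g⋈ : ∀ {z x} → z M.⋈ f x → x L.⋈ g z
    ⋈f⇒g⋈ {z} {x} = proj₁ (sym-fg x z) ∘ ⋈-sym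

    g⋈⇒⋈f : ∀ {z x} → x L.⋈ g z → z M.⋈ f x
    g⋈⇒⋈f {z} {x} = ⋈-sym ∘ proj₂ (sym-fg x z)

    symmetric⇒monotone : Monotone
    symmetric⇒monotone x≤x' = M.o-axiom λ z z⋈fx → g⋈⇒⋈f (⋈-monoˡᴸ x≤x' (⋈f⇒g⋈ z⋈fx))

    symmetric⇒⋁-below : ∀ X → f (L.⋁ X) M.≤ M.⋁ (image L M f X)
    symmetric⇒⋁-below X = M.o-axiom λ z z⋈f⋁X →
      let (x , x∈X , x⋈gz) = ⋈-⋁ᴸ X (⋈f⇒g⋈ z⋈f⋁X)
      in ⋈-monoʳᴹ (M.⋁-upper _ (x , x∈X , refl)) (g⋈⇒⋈f x⋈gz)

  monotone⇒⋁-above : Monotone → ∀ X → M.⋁ (image L M f X) M.≤ f (L.⋁ X)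
  monotone⇒⋁-above mono X = M.⋁-least _ λ { (x , x∈X , refl) → mono (L.⋁-upper X x∈X) }

  symmetrizable⇒preservesJoins : Symmetrizable L M f → PreservesJoins L M f
  symmetrizable⇒preservesJoins (g , sym-fg) X = M.≤-antisym
    (symmetric⇒⋁-below sym-fg X)
    (monotone⇒⋁-above (symmetric⇒monotone sym-fg) X)

  -- Preserving the join of the pair {x, x'} already forces monotonicity.
  preservesJoins⇒monotone : PreservesJoins L M f → Monotone
  preservesJoins⇒monotone pj {x} {x'} x≤x' = M.≤-trans
    (M.⋁-upper _ (x , inj₁ refl , refl))
    (≡⇒≤ (subst (λ v → M.⋁ (image L M f Pair) ≡ f v) (⋁-pair x≤x') (sym (pj Pair))))
    where
    Pair : Pred L.Carrier c
    Pair w = w ≡ x ⊎ w ≡ x'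

  -- For join-preserving f, the largest element of L whose image does not
  -- overlap y; it characterises the elements whose image misses y.
  module _ (pj : PreservesJoins L M f) where

    disjointPart : M.Carrier → L.Carrier
    disjointPart y = L.⋁ (λ t → ¬ (f t M.⋈ y))

    -- Its own image misses y: an overlap with f (⋁…) = ⋁ f[…] would split.
    disjointPart-disjoint : ∀ y → ¬ (f (disjointPart y) M.⋈ y)
    disjointPart-disjoint y fh⋈y
      with ⋈-⋁ᴹ _ (subst (λ v → v M.⋈ y) (pj (λ t → ¬ (f t M.⋈ y))) fh⋈y)
    ... | _ , (t , ¬ft⋈y , refl) , ft⋈y = ¬ft⋈y ft⋈y

    ≤disjointPart⇒¬⋈ : ∀ {t y} → t L.≤ disjointPart y → ¬ (f t M.⋈ y)
    ≤disjointPart⇒¬⋈ {t} {y} t≤h =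
      disjointPart-disjoint y ∘ ⋈-monoˡᴹ (preservesJoins⇒monotone pj t≤h)

    ¬⋈⇒≤disjointPart : ∀ {t y} → ¬ (f t M.⋈ y) → t L.≤ disjointPart y
    ¬⋈⇒≤disjointPart = L.⋁-upper _

    symmetric-of : DoubleNegationElimination c →
                   Symmetric L M f (λ y → disjointPart y *)
    symmetric-of dne x y =
        (λ fx⋈y → ≰⇒⋈* dne (λ x≤h → ≤disjointPart⇒¬⋈ x≤h fx⋈y))
      , (λ x⋈g → dne λ ¬fx⋈y → ⋈*⇒≰ x⋈g (¬⋈⇒≤disjointPart ¬fx⋈y))

proposition3p3 : ∀ {c : Level} (L M : OAlgebra c) (f : OAlgebra.Carrier L → OAlgebra.Carrier M) →
    (Symmetrizable L M f → PreservesJoins L M f)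
    × (ExcludedMiddle c → PreservesJoins L M f → Symmetrizable L M f)
proposition3p3 L M f =
    symmetrizable⇒preservesJoins
  , λ lem pj → (λ y → OverlapFacts._* L (disjointPart pj y)) , symmetric-of pj (em⇒dne lem)
  where open MapFacts L M f
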